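{- Every (non-null) graph $G$ contains a bipartite subgraph $H$ such that $$\kappa(H) \geq \max\{\mathsf{d}(G)/4,\ (\chi(G)-1)/8\}.$$
   Context: All graphs are finite and simple. $\kappa(H)$ is the vertex connectivity of $H$; $\mathsf{d}(G)=|E(G)|/|V(G)|$ is the density of $G$; $\chi(G)$ is the chromatic number. -}

module Defs where

open import Data.Nat using (ℕ; zero; suc; _<_; _≤_; _<ᵇ_; NonZero)
open import Data.Bool using (Bool; true; false; _∧_; if_then_else_)
open import Data.Fin using (Fin; toℕ)
open import Data.Fin.Subset using (Subset; _∉_; ∣_∣)
open import Data.List using (List; map)
open import Data.List using (allFin)
open import Data.Nat.ListAction using () renaming (sum to lsum)
open import Data.Product using (Σ; _×_; _,_)
open import Data.Integer using (+_) renaming (_-_ to _-ℤ_)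
open import Data.Rational using (ℚ; _/_; _*_; _⊔_)
open import Function.Definitions using (Injective)
open import Relation.Binary.PropositionalEquality using (_≡_; _≢_)

record Graph (n : ℕ) : Set where
  field
    adj     : Fin n → Fin n → Bool
    adj-sym : ∀ u v → adj u v ≡ adj v u
    adj-irr : ∀ u → adj u u ≡ false
open Graph public

Adj : ∀ {n} → Graph n → Fin n → Fin n → Set
Adj G u v = adj G u v ≡ true

edgeCount : ∀ {n} → Graph n → ℕ
edgeCount {n} G =
  lsum (map (λ i → lsum (map (λ j → if (toℕ i <ᵇ toℕ j) ∧ adj G i j then 1 else 0)
                              (allFin n)))
            (allFin n))

density : ∀ {n} .{{_ : NonZero n}} → Graph n → ℚ
density {n} G = (+ edgeCount G) / n

record Subgraph {m n} (H : Graph m) (G : Graph n) : Set where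
  field
    emb     : Fin m → Fin n
    emb-inj : Injective _≡_ _≡_ emb
    emb-adj : ∀ u v → Adj H u v → Adj G (emb u) (emb v)

Bipartite : ∀ {m} → Graph m → Set
Bipartite {m} H = Σ (Fin m → Bool) λ c → ∀ u v → Adj H u v → c u ≢ c v

data Reach {n} (G : Graph n) (X : Subset n) : Fin n → Fin n → Set where
  here : ∀ {u} → u ∉ X → Reach G X u u
  step : ∀ {u w v} → u ∉ X → Adj G u w → Reach G X w v → Reach G X u v

KConnected : ∀ {n} → Graph n → ℕ → Set
KConnected {n} G k =
  k < n × (∀ (X : Subset n) → ∣ X ∣ < k → ∀ u v → u ∉ X → v ∉ X → Reach G X u v)

IsConnectivity : ∀ {n} → Graph n → ℕ → Set
IsConnectivity G k = KConnected G k × (∀ j → KConnected G j → j ≤ k)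

Colourable : ∀ {n} → Graph n → ℕ → Set
Colourable {n} G k = Σ (Fin n → Fin k) λ c → ∀ u v → Adj G u v → c u ≢ c v

IsChromatic : ∀ {n} → Graph n → ℕ → Set
IsChromatic G k = Colourable G k × (∀ j → Colourable G j → k ≤ j)

module Submission where

-- Mader: a graph with n ≥ 2k + 1 vertices and more than 2k(n − k) edges has a (k + 1)-connected
-- subgraph. Delete a vertex of degree ≤ 2k, or, if there is none and the graph is not
-- (k + 1)-connected, split it along a separator of size ≤ k; in either case a smaller vertex set
-- still satisfies the edge bound. Colouring the vertices greedily, each against the majority of its
-- earlier neighbours, leaves a bipartite subgraph with at least half of the edges, so d(G) > 4k gives
-- a bipartite (k + 1)-connected subgraph. If χ(G) − 1 > 8k then G is not 8k-degenerate, so some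
-- subgraph has minimum degree > 8k and hence density > 4k. Taking for k + 1 the ceilings of d(G)/4
-- and (χ(G) − 1)/8 gives the two bounds.

open import Defs
open import Data.Nat using (ℕ; NonZero; zero; suc; s≤s; z≤n)
open import Data.Product using (Σ; _×_; _,_; proj₁; proj₂; ∃; ∃-syntax)
open import Data.Bool using (Bool; true; false; _∧_; _∨_; _xor_; not; if_then_else_; T)
import Data.Bool.Properties as Bool
open import Data.Empty using (⊥-elim)
open import Data.Fin using (Fin; toℕ; zero; suc)
import Data.Fin.Properties as Fin
open import Data.Fin.Subset using (Subset; _∈_; _∉_; _∪_; ⁅_⁆; _⊆_; ∣_∣)
import Data.Fin.Subset.Properties as Subset
import Data.List as List
import Data.List.Properties as List
open import Data.Nat.ListAction using () renaming (sum to lsum)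
open import Data.Sum using (_⊎_; inj₁; inj₂)
open import Data.Vec as Vec using ([]; _∷_)
import Data.Vec.Properties as Vec
open import Function using (_∘_)
open import Relation.Nullary using (¬_; Dec; yes; no; does)
open import Relation.Nullary.Decidable
  using (_×-dec_; ¬?; _→-dec_; dec-true; dec-false; map′; decidable-stable)
open import Relation.Binary.PropositionalEquality
  using (_≡_; _≢_; refl; sym; trans; cong; cong₂; subst; subst₂; module ≡-Reasoning)

-- The arithmetic of ℕ is opened only inside this module, so that below it _≤_, _*_ and _⊔_ are the
-- rational operations of the statement.
module Combinatorics where

  open import Data.Nat using (_+_; _∸_; _*_; _≤_; _<_; _<ᵇ_; _≤ᵇ_; _≤?_; _<?_)
  open import Data.Nat.Properties
  open import Data.Nat.Tactic.RingSolver using (solve-∀)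
  open import Data.Nat.Induction using (<-rec)
  open import Algebra.Properties.Semiring.Sum +-*-semiring
    using (sum; sum-syntax; sum-cong-≗; ∑-distrib-+; ∑-comm; *-distribˡ-sum; sum-replicate-zero)

  variable
    n m : ℕ

  𝟙 : Bool → ℕ
  𝟙 true  = 1
  𝟙 false = 0

  when : Bool → ℕ → ℕ
  when true  x = x
  when false _ = 0

  𝟙≤1 : ∀ b → 𝟙 b ≤ 1
  𝟙≤1 true  = ≤-refl
  𝟙≤1 false = z≤n

  when-𝟙 : ∀ b c → when b (𝟙 c) ≡ 𝟙 (b ∧ c)
  when-𝟙 true  c = refl
  when-𝟙 false c = refl

  true≢false : true ≢ false
  true≢false ()

  _==_ : Fin n → Fin n → Bool
  i == j = does (i Fin.≟ j)

  ==-refl : (v : Fin n) → v == v ≡ true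
  ==-refl v = dec-true (v Fin.≟ v) refl

  ==⇒≡ : {i j : Fin n} → i == j ≡ true → i ≡ j
  ==⇒≡ {i = i} {j} eq with i Fin.≟ j
  ... | yes i≡j = i≡j

  ∑-mono-≤ : {f g : Fin n → ℕ} → (∀ i → f i ≤ g i) → sum f ≤ sum g
  ∑-mono-≤ {zero}  f≤g = z≤n
  ∑-mono-≤ {suc n} f≤g = +-mono-≤ (f≤g zero) (∑-mono-≤ (f≤g ∘ suc))

  ∑-mono-< : {f g : Fin n → ℕ} (v : Fin n) → f v < g v → (∀ i → f i ≤ g i) → sum f < sum g
  ∑-mono-< {suc n} zero    fv<gv f≤g = +-mono-<-≤ fv<gv (∑-mono-≤ (f≤g ∘ suc))
  ∑-mono-< {suc n} (suc v) fv<gv f≤g = +-mono-≤-< (f≤g zero) (∑-mono-< v fv<gv (f≤g ∘ suc))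

  term≤∑ : (f : Fin n → ℕ) (v : Fin n) → f v ≤ sum f
  term≤∑ f zero    = m≤m+n _ _
  term≤∑ f (suc v) = ≤-trans (term≤∑ (f ∘ suc) v) (m≤n+m _ _)

  ∑-split : {f g h : Fin n → ℕ} → (∀ i → f i ≡ g i + h i) → sum f ≡ sum g + sum h
  ∑-split {g = g} {h} f≡g+h = trans (sum-cong-≗ f≡g+h) (∑-distrib-+ g h)

  ∑-when : ∀ b (f : Fin n → ℕ) → when b (sum f) ≡ ∑[ i < n ] when b (f i)
  ∑-when     true  f = refl
  ∑-when {n} false f = sym (sum-replicate-zero n)

  ∑-when-== : (v : Fin n) (f : Fin n → ℕ) → ∑[ i < n ] when (i == v) (f i) ≡ f v
  ∑-when-== {suc n} zero    f = trans (cong (f zero +_) (sum-replicate-zero n)) (+-identityʳ _)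
  ∑-when-== {suc n} (suc v) f = ∑-when-== v (f ∘ suc)

  ∑∑-row+column : (v : Fin n) (f : Fin n → Fin n → ℕ) →
    ∑[ i < n ] ∑[ j < n ] (when (i == v) (f i j) + when (j == v) (f i j)) ≡
    ∑[ j < n ] f v j + ∑[ i < n ] f i v
  ∑∑-row+column {n} v f = begin
    ∑[ i < n ] ∑[ j < n ] (when (i == v) (f i j) + when (j == v) (f i j))
      ≡⟨ ∑-split (λ i → ∑-distrib-+ (λ j → when (i == v) (f i j)) (λ j → when (j == v) (f i j))) ⟩
    ∑[ i < n ] ∑[ j < n ] when (i == v) (f i j) + ∑[ i < n ] ∑[ j < n ] when (j == v) (f i j)
      ≡⟨ cong₂ _+_ (sum-cong-≗ (λ i → sym (∑-when (i == v) (f i)))) (sum-cong-≗ (λ i → ∑-when-== v (f i))) ⟩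
    ∑[ i < n ] when (i == v) (∑[ j < n ] f i j) + ∑[ i < n ] f i v
      ≡⟨ cong (_+ ∑[ i < n ] f i v) (∑-when-== v (λ i → ∑[ j < n ] f i j)) ⟩
    ∑[ j < n ] f v j + ∑[ i < n ] f i v ∎
    where open ≡-Reasoning

  k≤2*k : ∀ k → k ≤ 2 * k
  k≤2*k k = m≤m+n k (k + 0)

  x+x<y+y⇒x<y : ∀ {x y} → x + x < y + y → x < y
  x+x<y+y⇒x<y x+x<y+y = ≰⇒> λ y≤x → <⇒≱ x+x<y+y (+-mono-≤ y≤x y≤x)

  2k[1+k]<e⇒2k[1+2k]<e+e : ∀ k e → 2 * k * suc k < e → 2 * k * suc (2 * k) < e + e
  2k[1+k]<e⇒2k[1+2k]<e+e k e dense = begin-strict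
    2 * k * suc (2 * k)              ≤⟨ m≤m+n _ (2 * k) ⟩
    2 * k * suc (2 * k) + 2 * k      ≡⟨ doubling k ⟨
    2 * k * suc k + 2 * k * suc k    <⟨ +-mono-< dense dense ⟩
    e + e                            ∎
    where
    open ≤-Reasoning
    doubling : ∀ k → 2 * k * suc k + 2 * k * suc k ≡ 2 * k * suc (2 * k) + 2 * k
    doubling = solve-∀

  c[1+x]<e+d⇒cx<e : ∀ c x e d → c * suc x < e + d → d ≤ c → c * x < e
  c[1+x]<e+d⇒cx<e c x e d c[1+x]<e+d d≤c = +-cancelˡ-< c (c * x) e (begin-strict
    c + c * x    ≡⟨ *-suc c x ⟨
    c * suc x    <⟨ c[1+x]<e+d ⟩
    e + d        ≤⟨ +-monoʳ-≤ e d≤c ⟩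
    e + c        ≡⟨ +-comm e c ⟩
    c + e        ∎)
    where open ≤-Reasoning

  [a∸k]+[b∸k]≤n∸k : ∀ {a b n k} → k ≤ a → k ≤ b → a + b ≤ n + k → (a ∸ k) + (b ∸ k) ≤ n ∸ k
  [a∸k]+[b∸k]≤n∸k {a} {b} {n} {k} k≤a k≤b a+b≤n+k = begin
    (a ∸ k) + (b ∸ k)              ≡⟨ m+n∸n≡m _ k ⟨
    (a ∸ k) + (b ∸ k) + k ∸ k      ≤⟨ ∸-monoˡ-≤ k (+-cancelʳ-≤ k _ n with-k) ⟩
    n ∸ k                          ∎
    where
    open ≤-Reasoning
    rearrange : ∀ x y k → x + y + k + k ≡ (k + x) + (k + y)
    rearrange = solve-∀
    with-k : (a ∸ k) + (b ∸ k) + k + k ≤ n + k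
    with-k = begin
      (a ∸ k) + (b ∸ k) + k + k       ≡⟨ rearrange (a ∸ k) (b ∸ k) k ⟩
      (k + (a ∸ k)) + (k + (b ∸ k))   ≡⟨ cong₂ _+_ (m+[n∸m]≡n k≤a) (m+[n∸m]≡n k≤b) ⟩
      a + b                           ≤⟨ a+b≤n+k ⟩
      n + k                           ∎

  -- K is ⌈ e / q ⌉.
  ceiling-witness : ∀ {ℓ} (P : ℕ → Set ℓ) q e → 0 < q → P 0 → (∀ k → q * k < e → P (suc k)) →
    ∃[ K ] P K × e ≤ q * K
  ceiling-witness P q zero    _   P0 _     = 0 , P0 , z≤n
  ceiling-witness P q (suc e) 0<q P0 P-suc
    with ceiling-witness P q e 0<q P0 (λ k qk<e → P-suc k (m≤n⇒m≤1+n qk<e))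
  ... | K , PK , e≤qK with suc e ≤? q * K
  ...   | yes 1+e≤qK = K , PK , 1+e≤qK
  ...   | no  1+e≰qK = suc K , P-suc K (s≤s (≤-reflexive (sym e≡qK))) , (begin
    suc e        ≡⟨ cong suc e≡qK ⟩
    suc (q * K)  ≤⟨ +-monoˡ-≤ (q * K) 0<q ⟩
    q + q * K    ≡⟨ *-suc q K ⟨
    q * suc K    ∎)
    where
    open ≤-Reasoning
    e≡qK : e ≡ q * K
    e≡qK = ≤-antisym e≤qK (≤-pred (≰⇒> 1+e≰qK))

  upper-bound : ∀ {ℓ} (P : ℕ → Set ℓ) {a b} → P a → P b → ∃[ c ] P c × a ≤ c × b ≤ c
  upper-bound P {a} {b} Pa Pb with ≤-total a b
  ... | inj₁ a≤b = b , Pb , a≤b , ≤-refl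
  ... | inj₂ b≤a = a , Pa , ≤-refl , b≤a

  VertexSet : ℕ → Set
  VertexSet n = Fin n → Bool

  ∣_∣ᵥ : VertexSet n → ℕ
  ∣ S ∣ᵥ = sum (𝟙 ∘ S)

  full : VertexSet n
  full _ = true

  _-ᵥ_ : VertexSet n → Fin n → VertexSet n
  (S -ᵥ v) w = if w == v then false else S w

  -ᵥ-⊆ : (S : VertexSet n) {v w : Fin n} → (S -ᵥ v) w ≡ true → S w ≡ true
  -ᵥ-⊆ S {v} {w} w∈S-v with w == v
  ... | false = w∈S-v

  -ᵥ-keeps : (S : VertexSet n) {v w : Fin n} → w == v ≡ false → S w ≡ true → (S -ᵥ v) w ≡ true
  -ᵥ-keeps S w≢v Sw rewrite w≢v = Sw

  -ᵥ-removes : (S : VertexSet n) (v : Fin n) → (S -ᵥ v) v ≡ false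
  -ᵥ-removes S v rewrite ==-refl v = refl

  ∣full∣≡n : ∀ n → ∣ full {n} ∣ᵥ ≡ n
  ∣full∣≡n zero    = refl
  ∣full∣≡n (suc n) = cong suc (∣full∣≡n n)

  ∣S∣<n : (S : VertexSet n) {v : Fin n} → S v ≡ false → ∣ S ∣ᵥ < n
  ∣S∣<n {n} S {v} Sv≡false = subst (∣ S ∣ᵥ <_) (∣full∣≡n n)
    (∑-mono-< v (subst (λ b → 𝟙 b < 1) (sym Sv≡false) ≤-refl) (𝟙≤1 ∘ S))

  ∣S∣≡1+∣S-v∣ : (S : VertexSet n) {v : Fin n} → S v ≡ true → ∣ S ∣ᵥ ≡ suc ∣ S -ᵥ v ∣ᵥ
  ∣S∣≡1+∣S-v∣ S {v} Sv≡true = begin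
    ∣ S ∣ᵥ                                            ≡⟨ ∑-split split ⟩
    ∣ S -ᵥ v ∣ᵥ + ∑[ i < _ ] when (i == v) (𝟙 (S i))  ≡⟨ cong (∣ S -ᵥ v ∣ᵥ +_) (∑-when-== v (𝟙 ∘ S)) ⟩
    ∣ S -ᵥ v ∣ᵥ + 𝟙 (S v)                             ≡⟨ cong (λ b → ∣ S -ᵥ v ∣ᵥ + 𝟙 b) Sv≡true ⟩
    ∣ S -ᵥ v ∣ᵥ + 1                                   ≡⟨ +-comm _ 1 ⟩
    suc ∣ S -ᵥ v ∣ᵥ                                   ∎
    where
    open ≡-Reasoning
    split : ∀ i → 𝟙 (S i) ≡ 𝟙 ((S -ᵥ v) i) + when (i == v) (𝟙 (S i))
    split i with i == v
    ... | true  = refl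
    ... | false = sym (+-identityʳ _)

  ∑-when-const : (S : VertexSet n) (c : ℕ) → ∑[ i < n ] when (S i) c ≡ c * ∣ S ∣ᵥ
  ∑-when-const S c = trans (sum-cong-≗ when≡*𝟙) (sym (*-distribˡ-sum c (𝟙 ∘ S)))
    where
    when≡*𝟙 : ∀ i → when (S i) c ≡ c * 𝟙 (S i)
    when≡*𝟙 i with S i
    ... | true  = sym (*-identityʳ c)
    ... | false = sym (*-zeroʳ c)

  _≺_ : Fin n → Fin n → Bool
  i ≺ j = toℕ i <ᵇ toℕ j

  <ᵇ-irrefl : ∀ a → (a <ᵇ a) ≡ false
  <ᵇ-irrefl zero    = refl
  <ᵇ-irrefl (suc a) = <ᵇ-irrefl a

  <ᵇ-trichotomy : ∀ a b → a ≢ b → 𝟙 (a <ᵇ b) + 𝟙 (b <ᵇ a) ≡ 1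
  <ᵇ-trichotomy zero    zero    a≢b = ⊥-elim (a≢b refl)
  <ᵇ-trichotomy zero    (suc b) a≢b = refl
  <ᵇ-trichotomy (suc a) zero    a≢b = refl
  <ᵇ-trichotomy (suc a) (suc b) a≢b = <ᵇ-trichotomy a b (a≢b ∘ cong suc)

  ≺-irrefl : (v : Fin n) → v ≺ v ≡ false
  ≺-irrefl v = <ᵇ-irrefl (toℕ v)

  ≺-trichotomy : {i j : Fin n} → i ≢ j → 𝟙 (i ≺ j) + 𝟙 (j ≺ i) ≡ 1
  ≺-trichotomy {i = i} {j} i≢j = <ᵇ-trichotomy (toℕ i) (toℕ j) (i≢j ∘ Fin.toℕ-injective)

  adj⇒≢ : (G : Graph n) {u v : Fin n} → Adj G u v → u ≢ v
  adj⇒≢ G {u} uv refl with trans (sym uv) (adj-irr G u)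
  ... | ()

  edgeIn : Graph n → VertexSet n → Fin n → Fin n → ℕ
  edgeIn G S i j = 𝟙 (S i ∧ S j ∧ i ≺ j ∧ adj G i j)

  edges : Graph n → VertexSet n → ℕ
  edges {n} G S = ∑[ i < n ] ∑[ j < n ] edgeIn G S i j

  degree : Graph n → VertexSet n → Fin n → ℕ
  degree {n} G S v = ∑[ j < n ] 𝟙 (S j ∧ adj G v j)

  edgeIn-∉ˡ : (G : Graph n) (S : VertexSet n) {v : Fin n} → S v ≡ false → ∀ j → edgeIn G S v j ≡ 0
  edgeIn-∉ˡ G S Sv≡false j rewrite Sv≡false = refl

  edgeIn-∉ʳ : (G : Graph n) (S : VertexSet n) {v : Fin n} → S v ≡ false → ∀ i → edgeIn G S i v ≡ 0
  edgeIn-∉ʳ G S Sv≡false i rewrite Sv≡false = cong 𝟙 (Bool.∧-zeroʳ (S i))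

  -- An edge vj is counted by edgeIn once, at whichever of its endpoints is smaller.
  𝟙adj≡edgeIn+edgeIn : (G : Graph n) (S : VertexSet n) {v : Fin n} → S v ≡ true → ∀ j →
    𝟙 (S j ∧ adj G v j) ≡ edgeIn G S v j + edgeIn G S j v
  𝟙adj≡edgeIn+edgeIn G S {v} Sv≡true j rewrite Sv≡true | adj-sym G j v with S j | adj G v j in vj
  ... | false | _     = refl
  ... | true  | false rewrite Bool.∧-zeroʳ (v ≺ j) | Bool.∧-zeroʳ (j ≺ v) = refl
  ... | true  | true  rewrite Bool.∧-identityʳ (v ≺ j) | Bool.∧-identityʳ (j ≺ v) =
    sym (≺-trichotomy (adj⇒≢ G vj))

  degree≡out+in : (G : Graph n) (S : VertexSet n) {v : Fin n} → S v ≡ true →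
    degree G S v ≡ ∑[ j < n ] edgeIn G S v j + ∑[ i < n ] edgeIn G S i v
  degree≡out+in G S Sv≡true = ∑-split (𝟙adj≡edgeIn+edgeIn G S Sv≡true)

  when-degree≡out+in : (G : Graph n) (S : VertexSet n) (v : Fin n) →
    when (S v) (degree G S v) ≡ ∑[ j < n ] edgeIn G S v j + ∑[ i < n ] edgeIn G S i v
  when-degree≡out+in {n} G S v = by-cases (S v) refl
    where
    by-cases : ∀ b → S v ≡ b →
      when b (degree G S v) ≡ ∑[ j < n ] edgeIn G S v j + ∑[ i < n ] edgeIn G S i v
    by-cases true  Sv = degree≡out+in G S Sv
    by-cases false Sv = sym (cong₂ _+_
      (trans (sum-cong-≗ (edgeIn-∉ˡ G S Sv)) (sum-replicate-zero n))
      (trans (sum-cong-≗ (edgeIn-∉ʳ G S Sv)) (sum-replicate-zero n)))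

  handshake : (G : Graph n) (S : VertexSet n) →
    ∑[ i < n ] when (S i) (degree G S i) ≡ edges G S + edges G S
  handshake {n} G S = begin
    ∑[ i < n ] when (S i) (degree G S i)
      ≡⟨ ∑-split (when-degree≡out+in G S) ⟩
    edges G S + ∑[ v < n ] ∑[ i < n ] edgeIn G S i v
      ≡⟨ cong (edges G S +_) (sym (∑-comm (edgeIn G S))) ⟩
    edges G S + edges G S ∎
    where open ≡-Reasoning

  edgeIn-loop : (G : Graph n) (S : VertexSet n) (v : Fin n) → edgeIn G S v v ≡ 0
  edgeIn-loop G S v rewrite ≺-irrefl v with S v
  ... | true  = refl
  ... | false = refl

  edgeIn-remove : (G : Graph n) (S : VertexSet n) (v i j : Fin n) →
    edgeIn G S i j ≡ edgeIn G (S -ᵥ v) i j + (when (i == v) (edgeIn G S i j) + when (j == v) (edgeIn G S i j))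
  edgeIn-remove G S v i j with i == v in i≡v | j == v in j≡v
  ... | true  | true  with refl ← ==⇒≡ {i = i} {v} i≡v | refl ← ==⇒≡ {i = j} {v} j≡v
    rewrite edgeIn-loop G S v = refl
  ... | true  | false = sym (+-identityʳ _)
  ... | false | true  rewrite Bool.∧-zeroʳ (S i) = refl
  ... | false | false = sym (+-identityʳ _)

  edges-remove : (G : Graph n) (S : VertexSet n) {v : Fin n} → S v ≡ true →
    edges G S ≡ edges G (S -ᵥ v) + degree G S v
  edges-remove {n} G S {v} Sv≡true = begin
    edges G S
      ≡⟨ ∑-split (λ i → ∑-split (edgeIn-remove G S v i)) ⟩
    edges G (S -ᵥ v) + ∑[ i < n ] ∑[ j < n ] (when (i == v) (edgeIn G S i j) + when (j == v) (edgeIn G S i j))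
      ≡⟨ cong (edges G (S -ᵥ v) +_) (∑∑-row+column v (edgeIn G S)) ⟩
    edges G (S -ᵥ v) + (∑[ j < n ] edgeIn G S v j + ∑[ i < n ] edgeIn G S i v)
      ≡⟨ cong (edges G (S -ᵥ v) +_) (sym (degree≡out+in G S Sv≡true)) ⟩
    edges G (S -ᵥ v) + degree G S v ∎
    where open ≡-Reasoning

  degree<∣S∣ : (G : Graph n) {S T : VertexSet n} {u : Fin n} →
    (∀ j → T j ≡ true → Adj G u j → S j ≡ true) → S u ≡ true → degree G T u < ∣ S ∣ᵥ
  degree<∣S∣ G {S} {T} {u} nbrs⊆S Su≡true = ∑-mono-< u at-u pointwise
    where
    at-u : 𝟙 (T u ∧ adj G u u) < 𝟙 (S u)
    at-u rewrite adj-irr G u | Bool.∧-zeroʳ (T u) | Su≡true = ≤-refl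
    pointwise : ∀ j → 𝟙 (T j ∧ adj G u j) ≤ 𝟙 (S j)
    pointwise j with T j in Tj | adj G u j in uj
    ... | false | _     = z≤n
    ... | true  | false = z≤n
    ... | true  | true  rewrite nbrs⊆S j Tj uj = ≤-refl

  degree-mono : (G : Graph n) {S T : VertexSet n} → (∀ {w} → S w ≡ true → T w ≡ true) →
    ∀ v → degree G S v ≤ degree G T v
  degree-mono G {S} {T} S⊆T v = ∑-mono-≤ pointwise
    where
    pointwise : ∀ w → 𝟙 (S w ∧ adj G v w) ≤ 𝟙 (T w ∧ adj G v w)
    pointwise w with S w in Sw
    ... | false = z≤n
    ... | true rewrite S⊆T Sw = ≤-refl

  2edges≤∣S∣² : (G : Graph n) (S : VertexSet n) → edges G S + edges G S ≤ (∣ S ∣ᵥ ∸ 1) * ∣ S ∣ᵥ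
  2edges≤∣S∣² {n} G S = begin
    edges G S + edges G S                 ≡⟨ handshake G S ⟨
    ∑[ i < n ] when (S i) (degree G S i)  ≤⟨ ∑-mono-≤ degree≤ ⟩
    ∑[ i < n ] when (S i) (∣ S ∣ᵥ ∸ 1)     ≡⟨ ∑-when-const S (∣ S ∣ᵥ ∸ 1) ⟩
    (∣ S ∣ᵥ ∸ 1) * ∣ S ∣ᵥ                  ∎
    where
    open ≤-Reasoning
    degree≤ : ∀ i → when (S i) (degree G S i) ≤ when (S i) (∣ S ∣ᵥ ∸ 1)
    degree≤ i with S i in Si
    ... | true  = ∸-monoˡ-≤ 1 (degree<∣S∣ G (λ j Sj _ → Sj) Si)
    ... | false = z≤n

  lsum-tabulate : (f : Fin n → ℕ) → lsum (List.tabulate f) ≡ sum f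
  lsum-tabulate {zero}  f = refl
  lsum-tabulate {suc n} f = cong (f zero +_) (lsum-tabulate (f ∘ suc))

  lsum-allFin : (f : Fin n → ℕ) → lsum (List.map f (List.allFin n)) ≡ sum f
  lsum-allFin {n} f = trans (cong lsum (List.map-tabulate (λ i → i) f)) (lsum-tabulate f)

  edgeCount≡edges : (G : Graph n) → edgeCount G ≡ edges G full
  edgeCount≡edges {n} G = trans (lsum-allFin row) (sum-cong-≗ λ i →
    trans (lsum-allFin (entry i)) (sum-cong-≗ λ j → if-1-0≡𝟙 (i ≺ j ∧ adj G i j)))
    where
    entry : Fin n → Fin n → ℕ
    entry i j = if i ≺ j ∧ adj G i j then 1 else 0
    row : Fin n → ℕ
    row i = lsum (List.map (entry i) (List.allFin n))
    if-1-0≡𝟙 : ∀ b → (if b then 1 else 0) ≡ 𝟙 b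
    if-1-0≡𝟙 true  = refl
    if-1-0≡𝟙 false = refl

  Subgraph-refl : (G : Graph n) → Subgraph G G
  Subgraph-refl G = record { emb = λ v → v ; emb-inj = λ eq → eq ; emb-adj = λ _ _ uv → uv }

  Subgraph-trans : {H : Graph m} {K : Graph n} {p : ℕ} {G : Graph p} →
    Subgraph H K → Subgraph K G → Subgraph H G
  Subgraph-trans H⊆K K⊆G = record
    { emb     = Subgraph.emb K⊆G ∘ Subgraph.emb H⊆K
    ; emb-inj = Subgraph.emb-inj H⊆K ∘ Subgraph.emb-inj K⊆G
    ; emb-adj = λ u v uv → Subgraph.emb-adj K⊆G _ _ (Subgraph.emb-adj H⊆K u v uv)
    }

  Bipartite-Subgraph : {H : Graph m} {G : Graph n} → Subgraph H G → Bipartite G → Bipartite H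
  Bipartite-Subgraph H⊆G (c , proper) =
    c ∘ Subgraph.emb H⊆G , λ u v uv → proper _ _ (Subgraph.emb-adj H⊆G u v uv)

  mutual
    enumerate : (S : VertexSet n) → Fin ∣ S ∣ᵥ → Fin n
    enumerate {suc n} S = enumerate-∷ (S zero) (S ∘ suc)

    enumerate-∷ : ∀ b (S : VertexSet n) → Fin (𝟙 b + ∣ S ∣ᵥ) → Fin (suc n)
    enumerate-∷ true  S zero    = zero
    enumerate-∷ true  S (suc i) = suc (enumerate S i)
    enumerate-∷ false S i       = suc (enumerate S i)

  mutual
    enumerate-injective : (S : VertexSet n) {i j : Fin ∣ S ∣ᵥ} → enumerate S i ≡ enumerate S j → i ≡ j
    enumerate-injective {suc n} S = enumerate-∷-injective (S zero) (S ∘ suc)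

    enumerate-∷-injective : ∀ b (S : VertexSet n) {i j : Fin (𝟙 b + ∣ S ∣ᵥ)} →
      enumerate-∷ b S i ≡ enumerate-∷ b S j → i ≡ j
    enumerate-∷-injective true  S {zero}  {zero}  _  = refl
    enumerate-∷-injective true  S {suc i} {suc j} eq = cong suc (enumerate-injective S (Fin.suc-injective eq))
    enumerate-∷-injective false S                 eq = enumerate-injective S (Fin.suc-injective eq)

  mutual
    enumerate-≺ : (S : VertexSet n) (i j : Fin ∣ S ∣ᵥ) → enumerate S i ≺ enumerate S j ≡ i ≺ j
    enumerate-≺ {suc n} S = enumerate-∷-≺ (S zero) (S ∘ suc)

    enumerate-∷-≺ : ∀ b (S : VertexSet n) (i j : Fin (𝟙 b + ∣ S ∣ᵥ)) →
      enumerate-∷ b S i ≺ enumerate-∷ b S j ≡ i ≺ j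
    enumerate-∷-≺ true  S zero    zero    = refl
    enumerate-∷-≺ true  S zero    (suc j) = refl
    enumerate-∷-≺ true  S (suc i) zero    = refl
    enumerate-∷-≺ true  S (suc i) (suc j) = enumerate-≺ S i j
    enumerate-∷-≺ false S i       j       = enumerate-≺ S i j

  mutual
    ∑-when≡∑-enumerate : (S : VertexSet n) (f : Fin n → ℕ) →
      ∑[ i < n ] when (S i) (f i) ≡ ∑[ i < ∣ S ∣ᵥ ] f (enumerate S i)
    ∑-when≡∑-enumerate {zero}  S f = refl
    ∑-when≡∑-enumerate {suc n} S f = ∑-when≡∑-enumerate-∷ (S zero) (S ∘ suc) f

    ∑-when≡∑-enumerate-∷ : ∀ b (S : VertexSet n) (f : Fin (suc n) → ℕ) →
      when b (f zero) + ∑[ i < n ] when (S i) (f (suc i)) ≡ ∑[ i < 𝟙 b + ∣ S ∣ᵥ ] f (enumerate-∷ b S i)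
    ∑-when≡∑-enumerate-∷ true  S f = cong (f zero +_) (∑-when≡∑-enumerate S (f ∘ suc))
    ∑-when≡∑-enumerate-∷ false S f = ∑-when≡∑-enumerate S (f ∘ suc)

  induced : Graph n → (S : VertexSet n) → Graph ∣ S ∣ᵥ
  induced G S = record
    { adj     = λ i j → adj G (enumerate S i) (enumerate S j)
    ; adj-sym = λ i j → adj-sym G (enumerate S i) (enumerate S j)
    ; adj-irr = λ i → adj-irr G (enumerate S i)
    }

  induced-Subgraph : (G : Graph n) (S : VertexSet n) → Subgraph (induced G S) G
  induced-Subgraph G S = record
    { emb = enumerate S ; emb-inj = enumerate-injective S ; emb-adj = λ _ _ uv → uv }

  edges-induced : (G : Graph n) (S : VertexSet n) → edges (induced G S) full ≡ edges G S
  edges-induced {n} G S = sym (begin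
    ∑[ i < n ] ∑[ j < n ] 𝟙 (S i ∧ S j ∧ i ≺ j ∧ adj G i j)
      ≡⟨ sum-cong-≗ (λ i → trans (sum-cong-≗ (λ j → when-when i j)) (sym (∑-when (S i) (rowTerm i)))) ⟩
    ∑[ i < n ] when (S i) (row i)
      ≡⟨ ∑-when≡∑-enumerate S row ⟩
    ∑[ i < ∣ S ∣ᵥ ] row (enumerate S i)
      ≡⟨ sum-cong-≗ (λ i → ∑-when≡∑-enumerate S (λ j → 𝟙 (enumerate S i ≺ j ∧ adj G (enumerate S i) j))) ⟩
    ∑[ i < ∣ S ∣ᵥ ] ∑[ j < ∣ S ∣ᵥ ] 𝟙 (enumerate S i ≺ enumerate S j ∧ adj G (enumerate S i) (enumerate S j))
      ≡⟨ sum-cong-≗ (λ i → sum-cong-≗ (λ j →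
           cong (λ b → 𝟙 (b ∧ adj G (enumerate S i) (enumerate S j))) (enumerate-≺ S i j))) ⟩
    edges (induced G S) full ∎)
    where
    open ≡-Reasoning
    rowTerm : Fin n → Fin n → ℕ
    rowTerm i j = when (S j) (𝟙 (i ≺ j ∧ adj G i j))
    row : Fin n → ℕ
    row i = sum (rowTerm i)
    when-when : ∀ i j → 𝟙 (S i ∧ S j ∧ i ≺ j ∧ adj G i j) ≡ when (S i) (when (S j) (𝟙 (i ≺ j ∧ adj G i j)))
    when-when i j = sym (trans (cong (when (S i)) (when-𝟙 (S j) _)) (when-𝟙 (S i) _))

  -- Walks and k-connectivity

  module _ {n} (G : Graph n) where

    Reach-start∉ : {X : Subset n} {u v : Fin n} → Reach G X u v → u ∉ X
    Reach-start∉ (here u∉X)     = u∉X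
    Reach-start∉ (step u∉X _ _) = u∉X

    Reach-antitone : {X Y : Subset n} → X ⊆ Y → {u v : Fin n} → Reach G Y u v → Reach G X u v
    Reach-antitone X⊆Y (here u∉Y)        = here (u∉Y ∘ X⊆Y)
    Reach-antitone X⊆Y (step u∉Y uw w⇝v) = step (u∉Y ∘ X⊆Y) uw (Reach-antitone X⊆Y w⇝v)

    Reach-snoc : {X : Subset n} {u w w′ : Fin n} → Reach G X u w → w′ ∉ X → Adj G w w′ → Reach G X u w′
    Reach-snoc (here u∉X)        w′∉X ww′ = step u∉X ww′ (here w′∉X)
    Reach-snoc (step u∉X uw w⇝v) w′∉X ww′ = step u∉X uw (Reach-snoc w⇝v w′∉X ww′)

    ∉-∪⁅⁆ : {X : Subset n} {u a : Fin n} → a ∉ X → a ≢ u → a ∉ X ∪ ⁅ u ⁆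
    ∉-∪⁅⁆ {X} {u} a∉X a≢u a∈X∪u with Subset.x∈p∪q⁻ X ⁅ u ⁆ a∈X∪u
    ... | inj₁ a∈X = a∉X a∈X
    ... | inj₂ a∈u = a≢u (Subset.x∈⁅y⁆⇒x≡y u a∈u)

    -- Cut the walk after its last visit to u.
    Reach-avoid-or-leave : {X : Subset n} {u a v : Fin n} → v ≢ u → Reach G X a v →
      Reach G (X ∪ ⁅ u ⁆) a v ⊎ ∃[ w ] Adj G u w × Reach G (X ∪ ⁅ u ⁆) w v
    Reach-avoid-or-leave v≢u (here v∉X) = inj₁ (here (∉-∪⁅⁆ v∉X v≢u))
    Reach-avoid-or-leave {u = u} {a} v≢u (step a∉X aw w⇝v) with Reach-avoid-or-leave v≢u w⇝v
    ... | inj₂ leave = inj₂ leave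
    ... | inj₁ w⇝v′ with a Fin.≟ u
    ...   | yes refl = inj₂ (_ , aw , w⇝v′)
    ...   | no a≢u   = inj₁ (step (∉-∪⁅⁆ a∉X a≢u) aw w⇝v′)

    ∣X∣≥n⇒∈X : {X : Subset n} → n ∸ ∣ X ∣ ≤ 0 → ∀ u → u ∈ X
    ∣X∣≥n⇒∈X {X} n≤∣X∣ u = subst (u ∈_) (sym (Subset.∣p∣≡n⇒p≡⊤ ∣X∣≡n)) Subset.∈⊤
      where
      ∣X∣≡n : ∣ X ∣ ≡ n
      ∣X∣≡n = ≤-antisym (Subset.∣p∣≤n X) (m∸n≡0⇒m≤n (n≤0⇒n≡0 n≤∣X∣))

    -- u reaches v in G − X iff u ∉ X and u = v or some neighbour of u reaches v in G − (X ∪ {u}).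
    Reach?-within : ∀ t (X : Subset n) → n ∸ ∣ X ∣ ≤ t → ∀ u v → Dec (Reach G X u v)
    Reach?-within t X bound u v with u Subset.∈? X | u Fin.≟ v
    ... | yes u∈X | _        = no (λ u⇝v → Reach-start∉ u⇝v u∈X)
    ... | no u∉X  | yes refl = yes (here u∉X)
    ... | no u∉X  | no u≢v   with t
    ...   | zero  = ⊥-elim (u∉X (∣X∣≥n⇒∈X bound u))
    ...   | suc t = map′ forward backward
                      (Fin.any? λ w → (adj G u w Bool.≟ true) ×-dec Reach?-within t X′ bound′ w v)
      where
      X′ : Subset n
      X′ = X ∪ ⁅ u ⁆
      ∣X∣<∣X′∣ : ∣ X ∣ < ∣ X′ ∣
      ∣X∣<∣X′∣ = Subset.p⊂q⇒∣p∣<∣q∣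
        (Subset.p⊆p∪q ⁅ u ⁆ , u , Subset.x∈p∪q⁺ (inj₂ (Subset.x∈⁅x⁆ u)) , u∉X)
      bound′ : n ∸ ∣ X′ ∣ ≤ t
      bound′ = ≤-trans (∸-monoʳ-≤ n ∣X∣<∣X′∣)
                 (≤-trans (≤-reflexive (sym (pred[m∸n]≡m∸[1+n] n ∣ X ∣))) (∸-monoˡ-≤ 1 bound))
      forward : ∃[ w ] Adj G u w × Reach G X′ w v → Reach G X u v
      forward (w , uw , w⇝v) = step u∉X uw (Reach-antitone (Subset.p⊆p∪q ⁅ u ⁆) w⇝v)
      backward : Reach G X u v → ∃[ w ] Adj G u w × Reach G X′ w v
      backward u⇝v with Reach-avoid-or-leave (u≢v ∘ sym) u⇝v
      ... | inj₁ u⇝v′ = ⊥-elim (Reach-start∉ u⇝v′ (Subset.x∈p∪q⁺ (inj₂ (Subset.x∈⁅x⁆ u))))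
      ... | inj₂ leave = leave

    Reach? : ∀ X u v → Dec (Reach G X u v)
    Reach? X = Reach?-within (n ∸ ∣ X ∣) X ≤-refl

    SmallSeparator : ℕ → Subset n → Set
    SmallSeparator k X = ∣ X ∣ < k × ∃[ u ] ∃[ v ] u ∉ X × v ∉ X × ¬ Reach G X u v

    SmallSeparator? : ∀ k X → Dec (SmallSeparator k X)
    SmallSeparator? k X = (∣ X ∣ <? k) ×-dec Fin.any? λ u → Fin.any? λ v →
      ¬? (u Subset.∈? X) ×-dec ¬? (v Subset.∈? X) ×-dec ¬? (Reach? X u v)

    noSmallSeparator⇒connected : ∀ {k} → ¬ ∃ (SmallSeparator k) →
      ∀ (X : Subset n) → ∣ X ∣ < k → ∀ u v → u ∉ X → v ∉ X → Reach G X u v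
    noSmallSeparator⇒connected none X ∣X∣<k u v u∉X v∉X =
      decidable-stable (Reach? X u v) λ ¬u⇝v → none (X , ∣X∣<k , u , v , u∉X , v∉X , ¬u⇝v)

    KConnected? : ∀ k → Dec (KConnected G k)
    KConnected? k with k <? n | Subset.anySubset? (SmallSeparator? k)
    ... | no k≮n  | _    = no (k≮n ∘ proj₁)
    ... | yes k<n | no none = yes (k<n , noSmallSeparator⇒connected none)
    ... | yes _   | yes (X , ∣X∣<k , u , v , u∉X , v∉X , ¬u⇝v) =
      no λ conn → ¬u⇝v (proj₂ conn X ∣X∣<k u v u∉X v∉X)

    ¬KConnected⇒SmallSeparator : ∀ {k} → k < n → ¬ KConnected G k → ∃ (SmallSeparator k)
    ¬KConnected⇒SmallSeparator k<n ¬conn = decidable-stable (Subset.anySubset? (SmallSeparator? _))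
      λ none → ¬conn (k<n , noSmallSeparator⇒connected none)

  KConnected-maximum : ∀ {p} (H : Graph p) {k} → KConnected H k → ∃[ κ ] IsConnectivity H κ × k ≤ κ
  KConnected-maximum {p} H {k} conn = search p (λ j conn′ → <⇒≤ (proj₁ conn′)) (<⇒≤ (proj₁ conn))
    where
    search : ∀ t → (∀ j → KConnected H j → j ≤ t) → k ≤ t → ∃[ κ ] IsConnectivity H κ × k ≤ κ
    search t bounded k≤t with KConnected? H t
    ... | yes conn-t = t , (conn-t , bounded) , k≤t
    search zero    bounded z≤n | no ¬conn = ⊥-elim (¬conn conn)
    search (suc t) bounded k≤t | no ¬conn =
      search t (λ j conn-j → below (bounded j conn-j) conn-j) (below k≤t conn)
      where
      below : ∀ {j} → j ≤ suc t → KConnected H j → j ≤ t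
      below j≤1+t conn-j = ≤-pred (≤∧≢⇒< j≤1+t λ { refl → ¬conn conn-j })

  -- Separations

  𝟙-cover : ∀ a₁ a₂ b₁ b₂ c → (c ≡ true → (a₁ ≡ true × a₂ ≡ true) ⊎ (b₁ ≡ true × b₂ ≡ true)) →
    𝟙 c ≤ 𝟙 (a₁ ∧ a₂ ∧ c) + 𝟙 (b₁ ∧ b₂ ∧ c)
  𝟙-cover _  _  _  _  false _       = z≤n
  𝟙-cover a₁ a₂ b₁ b₂ true  covered with covered refl
  ... | inj₁ (refl , refl) = s≤s z≤n
  ... | inj₂ (refl , refl) = m≤n+m 1 (𝟙 (a₁ ∧ a₂ ∧ true))

  edges≤edges+edges : (G : Graph n) (S₁ S₂ : VertexSet n) →
    (∀ i j → Adj G i j → (S₁ i ≡ true × S₁ j ≡ true) ⊎ (S₂ i ≡ true × S₂ j ≡ true)) →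
    edges G full ≤ edges G S₁ + edges G S₂
  edges≤edges+edges {n} G S₁ S₂ inside = begin
    edges G full
      ≤⟨ ∑-mono-≤ (λ i → ∑-mono-≤ (covered i)) ⟩
    ∑[ i < n ] ∑[ j < n ] (edgeIn G S₁ i j + edgeIn G S₂ i j)
      ≡⟨ ∑-split (λ i → ∑-distrib-+ (edgeIn G S₁ i) (edgeIn G S₂ i)) ⟩
    edges G S₁ + edges G S₂ ∎
    where
    open ≤-Reasoning
    covered : ∀ i j → edgeIn G full i j ≤ edgeIn G S₁ i j + edgeIn G S₂ i j
    covered i j = 𝟙-cover (S₁ i) (S₁ j) (S₂ i) (S₂ j) (i ≺ j ∧ adj G i j)
      (λ ij → inside i j (Bool.∧-conicalʳ (i ≺ j) (adj G i j) ij))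

  ∣X∣≡∣lookup∣ : (X : Subset n) → ∣ X ∣ ≡ ∣ Vec.lookup X ∣ᵥ
  ∣X∣≡∣lookup∣ []          = refl
  ∣X∣≡∣lookup∣ (true ∷ X)  = cong suc (∣X∣≡∣lookup∣ X)
  ∣X∣≡∣lookup∣ (false ∷ X) = ∣X∣≡∣lookup∣ X

  record Separation (G : Graph n) (X : Subset n) (u v : Fin n) : Set where
    field
      side₁ side₂   : VertexSet n
      edges-covered : edges G full ≤ edges G side₁ + edges G side₂
      sizes-overlap : ∣ side₁ ∣ᵥ + ∣ side₂ ∣ᵥ ≤ n + ∣ X ∣
      u∈side₁       : side₁ u ≡ true
      v∉side₁       : side₁ v ≡ false
      v∈side₂       : side₂ v ≡ true
      u∉side₂       : side₂ u ≡ false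
      N[u]⊆side₁    : ∀ j → Adj G u j → side₁ j ≡ true
      N[v]⊆side₂    : ∀ j → Adj G v j → side₂ j ≡ true

  -- side₁ is X together with everything reachable from u in G − X; side₂ is everything else.
  separation : (G : Graph n) {X : Subset n} {u v : Fin n} →
    u ∉ X → v ∉ X → ¬ Reach G X u v → Separation G X u v
  separation {n} G {X} {u} {v} u∉X v∉X ¬u⇝v = record
    { side₁         = side₁
    ; side₂         = side₂
    ; edges-covered = edges≤edges+edges G side₁ side₂ inside
    ; sizes-overlap = sizes
    ; u∈side₁       = side₁-reached reached-u
    ; v∉side₁       = trans (cong (_∨ Vec.lookup X v) reached-v) (∉⇒lookup v∉X)
    ; v∈side₂       = cong not reached-v
    ; u∉side₂       = cong not reached-u
    ; N[u]⊆side₁    = λ j uj → side₁-adj reached-u uj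
    ; N[v]⊆side₂    = N[v]⊆side₂
    }
    where
    reached : VertexSet n
    reached w = does (Reach? G X u w)

    reached-sound : ∀ {w} → reached w ≡ true → Reach G X u w
    reached-sound {w} _ with Reach? G X u w
    ... | yes u⇝w = u⇝w

    reached-closed : ∀ {w w′} → reached w ≡ true → Adj G w w′ → w′ ∉ X → reached w′ ≡ true
    reached-closed w∈R ww′ w′∉X = dec-true (Reach? G X u _) (Reach-snoc G (reached-sound w∈R) w′∉X ww′)

    reached-u : reached u ≡ true
    reached-u = dec-true (Reach? G X u u) (here u∉X)

    reached-v : reached v ≡ false
    reached-v = dec-false (Reach? G X u v) ¬u⇝v

    ∉⇒lookup : ∀ {w} → w ∉ X → Vec.lookup X w ≡ false
    ∉⇒lookup {w} w∉X with Vec.lookup X w in X[w]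
    ... | true  = ⊥-elim (w∉X (Vec.lookup⇒[]= w X X[w]))
    ... | false = refl

    side₁ side₂ : VertexSet n
    side₁ w = reached w ∨ Vec.lookup X w
    side₂ w = not (reached w)

    side₁-reached : ∀ {w} → reached w ≡ true → side₁ w ≡ true
    side₁-reached w∈R = cong (_∨ _) w∈R

    side₁-X : ∀ {w} → w ∈ X → side₁ w ≡ true
    side₁-X {w} w∈X = trans (cong (reached w ∨_) (Vec.[]=⇒lookup w∈X)) (Bool.∨-zeroʳ (reached w))

    side₁-adj : ∀ {w w′} → reached w ≡ true → Adj G w w′ → side₁ w′ ≡ true
    side₁-adj {w′ = w′} w∈R ww′ with w′ Subset.∈? X
    ... | yes w′∈X = side₁-X w′∈X
    ... | no  w′∉X = side₁-reached (reached-closed w∈R ww′ w′∉X)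

    inside : ∀ i j → Adj G i j → (side₁ i ≡ true × side₁ j ≡ true) ⊎ (side₂ i ≡ true × side₂ j ≡ true)
    inside i j ij = by-cases (reached i) (reached j) refl refl
      where
      by-cases : ∀ a b → reached i ≡ a → reached j ≡ b →
        (side₁ i ≡ true × side₁ j ≡ true) ⊎ (side₂ i ≡ true × side₂ j ≡ true)
      by-cases true  _     i∈R _   = inj₁ (side₁-reached i∈R , side₁-adj i∈R ij)
      by-cases false false i∉R j∉R = inj₂ (cong not i∉R , cong not j∉R)
      by-cases false true  i∉R j∈R with i Subset.∈? X
      ... | yes i∈X = inj₁ (side₁-X i∈X , side₁-reached j∈R)
      ... | no  i∉X with () ← trans (sym i∉R) (reached-closed j∈R (trans (adj-sym G j i) ij) i∉X)

    N[v]⊆side₂ : ∀ j → Adj G v j → side₂ j ≡ true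
    N[v]⊆side₂ j vj = by-cases (reached j) refl
      where
      by-cases : ∀ b → reached j ≡ b → side₂ j ≡ true
      by-cases false j∉R = cong not j∉R
      by-cases true  j∈R with () ← trans (sym reached-v) (reached-closed j∈R (trans (adj-sym G j v) vj) v∉X)

    sizes : ∣ side₁ ∣ᵥ + ∣ side₂ ∣ᵥ ≤ n + ∣ X ∣
    sizes = begin
      ∣ side₁ ∣ᵥ + ∣ side₂ ∣ᵥ                     ≡⟨ ∑-distrib-+ (𝟙 ∘ side₁) (𝟙 ∘ side₂) ⟨
      ∑[ w < n ] (𝟙 (side₁ w) + 𝟙 (side₂ w))      ≤⟨ ∑-mono-≤ (λ w → pointwise (reached w) (Vec.lookup X w)) ⟩
      ∑[ w < n ] (1 + 𝟙 (Vec.lookup X w))         ≡⟨ ∑-distrib-+ (λ _ → 1) (𝟙 ∘ Vec.lookup X) ⟩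
      ∣ full {n} ∣ᵥ + ∣ Vec.lookup X ∣ᵥ            ≡⟨ cong₂ _+_ (∣full∣≡n n) (sym (∣X∣≡∣lookup∣ X)) ⟩
      n + ∣ X ∣                                   ∎
      where
      open ≤-Reasoning
      pointwise : ∀ a x → 𝟙 (a ∨ x) + 𝟙 (not a) ≤ 1 + 𝟙 x
      pointwise true  true  = s≤s z≤n
      pointwise true  false = ≤-refl
      pointwise false true  = ≤-refl
      pointwise false false = ≤-refl

  -- Mader's theorem

  ConnectedSubgraph : Graph n → ℕ → Set
  ConnectedSubgraph G k = Σ ℕ λ p → Σ (Graph p) λ H → Subgraph H G × KConnected H k

  ConnectedSubgraph-lift : {H : Graph m} {G : Graph n} {k : ℕ} →
    Subgraph H G → ConnectedSubgraph H k → ConnectedSubgraph G k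
  ConnectedSubgraph-lift H⊆G (p , K , K⊆H , conn) = p , K , Subgraph-trans K⊆H H⊆G , conn

  -- The invariant in the proof of Mader's theorem (Diestel, Graph Theory, Thm. 1.4.3).
  MaderDense : ℕ → Graph n → VertexSet n → Set
  MaderDense k G S = 2 * k < ∣ S ∣ᵥ × 2 * k * (∣ S ∣ᵥ ∸ k) < edges G S

  MaderDense? : ∀ k (G : Graph n) S → Dec (MaderDense k G S)
  MaderDense? k G S = (2 * k <? ∣ S ∣ᵥ) ×-dec (2 * k * (∣ S ∣ᵥ ∸ k) <? edges G S)

  MaderDense-induced : ∀ {k} (G : Graph n) (S : VertexSet n) →
    MaderDense k G S → MaderDense k (induced G S) full
  MaderDense-induced G S rewrite ∣full∣≡n ∣ S ∣ᵥ | edges-induced G S = λ dense → dense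

  MaderDense⇒2k+1<∣S∣ : ∀ {k} (G : Graph n) (S : VertexSet n) → MaderDense k G S → suc (2 * k) < ∣ S ∣ᵥ
  MaderDense⇒2k+1<∣S∣ {k = k} G S (2k<∣S∣ , dense) = ≤∧≢⇒< 2k<∣S∣ not-tight
    where
    not-tight : suc (2 * k) ≢ ∣ S ∣ᵥ
    not-tight 2k+1≡∣S∣ = <⇒≱
      (2k[1+k]<e⇒2k[1+2k]<e+e k (edges G S)
        (subst (λ s → 2 * k * s < edges G S) 1+2k∸k≡1+k
          (subst (λ s → 2 * k * (s ∸ k) < edges G S) (sym 2k+1≡∣S∣) dense)))
      (subst (λ s → edges G S + edges G S ≤ (s ∸ 1) * s) (sym 2k+1≡∣S∣) (2edges≤∣S∣² G S))
      where
      split : ∀ k → suc (2 * k) ≡ k + suc k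
      split = solve-∀
      1+2k∸k≡1+k : suc (2 * k) ∸ k ≡ suc k
      1+2k∸k≡1+k = trans (cong (_∸ k) (split k)) (m+n∸m≡n k (suc k))

  MaderDense-full⇒k+1<n : ∀ {k} (G : Graph n) → MaderDense k G full → suc k < n
  MaderDense-full⇒k+1<n {n} {k} G dense =
    ≤-trans (s≤s (s≤s (k≤2*k k)))
      (subst (suc (2 * k) <_) (∣full∣≡n n) (MaderDense⇒2k+1<∣S∣ {k = k} G full dense))

  MaderDense-remove : ∀ {k} (G : Graph n) (S : VertexSet n) {v : Fin n} → S v ≡ true →
    degree G S v ≤ 2 * k → MaderDense k G S → MaderDense k G (S -ᵥ v)
  MaderDense-remove {k = k} G S {v} Sv≡true low dense@(_ , edges>) = 2k<∣S-v∣ , edges-v>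
    where
    ∣S∣≡ : ∣ S ∣ᵥ ≡ suc ∣ S -ᵥ v ∣ᵥ
    ∣S∣≡ = ∣S∣≡1+∣S-v∣ S Sv≡true
    2k<∣S-v∣ : 2 * k < ∣ S -ᵥ v ∣ᵥ
    2k<∣S-v∣ = ≤-pred (subst (suc (suc (2 * k)) ≤_) ∣S∣≡ (MaderDense⇒2k+1<∣S∣ {k = k} G S dense))
    k≤∣S-v∣ : k ≤ ∣ S -ᵥ v ∣ᵥ
    k≤∣S-v∣ = ≤-trans (k≤2*k k) (<⇒≤ 2k<∣S-v∣)
    edges-v> : 2 * k * (∣ S -ᵥ v ∣ᵥ ∸ k) < edges G (S -ᵥ v)
    edges-v> = c[1+x]<e+d⇒cx<e (2 * k) _ _ (degree G S v)
      (subst₂ (λ x y → 2 * k * x < y)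
        (trans (cong (_∸ k) ∣S∣≡) (+-∸-assoc 1 k≤∣S-v∣)) (edges-remove G S Sv≡true) edges>)
      low

  MaderDense-separation : ∀ {k} (G : Graph n) {X : Subset n} {u v : Fin n} →
    MaderDense k G full → (∀ w → 2 * k < degree G full w) → ∣ X ∣ ≤ k → (sep : Separation G X u v) →
    MaderDense k G (Separation.side₁ sep) ⊎ MaderDense k G (Separation.side₂ sep)
  MaderDense-separation {n} {k} G (_ , dense) high ∣X∣≤k sep
    with MaderDense? k G (Separation.side₁ sep) | MaderDense? k G (Separation.side₂ sep)
  ... | yes dense₁ | _          = inj₁ dense₁
  ... | no _       | yes dense₂ = inj₂ dense₂
  ... | no sparse₁ | no sparse₂ =
    ⊥-elim (<⇒≱ dense (subst (λ s → edges G full ≤ 2 * k * (s ∸ k)) (sym (∣full∣≡n n)) sparse))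
    where
    open Separation sep
    big₁ : 2 * k < ∣ side₁ ∣ᵥ
    big₁ = <-trans (high _) (degree<∣S∣ G (λ j _ → N[u]⊆side₁ j) u∈side₁)
    big₂ : 2 * k < ∣ side₂ ∣ᵥ
    big₂ = <-trans (high _) (degree<∣S∣ G (λ j _ → N[v]⊆side₂ j) v∈side₂)
    k≤ : ∀ {s} → 2 * k < s → k ≤ s
    k≤ 2k<s = ≤-trans (k≤2*k k) (<⇒≤ 2k<s)
    sparse : edges G full ≤ 2 * k * (n ∸ k)
    sparse = begin
      edges G full
        ≤⟨ edges-covered ⟩
      edges G side₁ + edges G side₂
        ≤⟨ +-mono-≤ (≮⇒≥ (λ e> → sparse₁ (big₁ , e>))) (≮⇒≥ (λ e> → sparse₂ (big₂ , e>))) ⟩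
      2 * k * (∣ side₁ ∣ᵥ ∸ k) + 2 * k * (∣ side₂ ∣ᵥ ∸ k)
        ≡⟨ *-distribˡ-+ (2 * k) _ _ ⟨
      2 * k * ((∣ side₁ ∣ᵥ ∸ k) + (∣ side₂ ∣ᵥ ∸ k))
        ≤⟨ *-monoʳ-≤ (2 * k) ([a∸k]+[b∸k]≤n∸k (k≤ big₁) (k≤ big₂)
                               (≤-trans sizes-overlap (+-monoʳ-≤ n ∣X∣≤k))) ⟩
      2 * k * (n ∸ k) ∎
      where open ≤-Reasoning

  mader-step : ∀ {k} (G : Graph n) →
    (∀ S → ∣ S ∣ᵥ < n → MaderDense k G S → ConnectedSubgraph G (suc k)) →
    MaderDense k G full → ConnectedSubgraph G (suc k)
  mader-step {n} {k} G shrink dense with Fin.any? (λ v → degree G full v ≤? 2 * k)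
  ... | yes (v , low) =
    shrink (full -ᵥ v) (∣S∣<n (full -ᵥ v) {v} (-ᵥ-removes full v))
      (MaderDense-remove {k = k} G full {v} refl low dense)
  ... | no ¬low with KConnected? G (suc k)
  ...   | yes conn = n , G , Subgraph-refl G , conn
  ...   | no ¬conn with ¬KConnected⇒SmallSeparator G (MaderDense-full⇒k+1<n {k = k} G dense) ¬conn
  ...     | X , ∣X∣≤k , u , v , u∉X , v∉X , ¬u⇝v
    with sep ← separation G u∉X v∉X ¬u⇝v
    with MaderDense-separation G dense (λ w → ≰⇒> (λ low → ¬low (w , low))) (≤-pred ∣X∣≤k) sep
  ...       | inj₁ dense₁ = shrink _ (∣S∣<n _ (Separation.v∉side₁ sep)) dense₁
  ...       | inj₂ dense₂ = shrink _ (∣S∣<n _ (Separation.u∉side₂ sep)) dense₂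

  mader : ∀ k (G : Graph n) → MaderDense k G full → ConnectedSubgraph G (suc k)
  mader {n} k = <-rec P shrinking n
    where
    P : ℕ → Set
    P n = (G : Graph n) → MaderDense k G full → ConnectedSubgraph G (suc k)
    shrinking : ∀ n → (∀ {m} → m < n → P m) → P n
    shrinking n ih G = mader-step G λ S smaller dense →
      ConnectedSubgraph-lift (induced-Subgraph G S)
        (ih smaller (induced G S) (MaderDense-induced {k = k} G S dense))

  -- A bipartite subgraph with half of the edges

  same : Bool → Bool → Bool
  same true  b = b
  same false b = not b

  xor≡same-not : ∀ a b → (a xor b) ≡ same a (not b)
  xor≡same-not true  true  = refl
  xor≡same-not true  false = refl
  xor≡same-not false true  = refl
  xor≡same-not false false = refl

  cut : Graph n → (Fin n → Bool) → Graph n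
  cut G c = record
    { adj     = λ i j → adj G i j ∧ (c i xor c j)
    ; adj-sym = λ i j → cong₂ _∧_ (adj-sym G i j) (xor-comm (c i) (c j))
    ; adj-irr = λ i → cong (_∧ (c i xor c i)) (adj-irr G i)
    }
    where
    xor-comm : ∀ a b → (a xor b) ≡ (b xor a)
    xor-comm true  true  = refl
    xor-comm true  false = refl
    xor-comm false true  = refl
    xor-comm false false = refl

  cut-Subgraph : (G : Graph n) (c : Fin n → Bool) → Subgraph (cut G c) G
  cut-Subgraph G c = record
    { emb = λ v → v ; emb-inj = λ eq → eq ; emb-adj = λ u v uv → Bool.∧-conicalˡ (adj G u v) _ uv }

  cut-Bipartite : (G : Graph n) (c : Fin n → Bool) → Bipartite (cut G c)
  cut-Bipartite G c = c , λ u v uv cu≡cv → true≢false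
    (trans (sym (Bool.∧-conicalʳ (adj G u v) _ uv))
           (trans (cong (c u xor_) (sym cu≡cv)) (Bool.xor-same (c u))))

  backDegree : Graph n → Fin n → ℕ
  backDegree {n} G j = ∑[ i < n ] 𝟙 (i ≺ j ∧ adj G i j)

  edges≡∑backDegree : (G : Graph n) → edges G full ≡ ∑[ j < n ] backDegree G j
  edges≡∑backDegree G = ∑-comm (λ i j → 𝟙 (i ≺ j ∧ adj G i j))

  module GreedyCut {n} (G : Graph n) where

    earlier : (Fin n → Bool) → Fin n → Bool → ℕ
    earlier c j b = ∑[ i < n ] 𝟙 (i ≺ j ∧ adj G i j ∧ same (c i) b)

    choose : (Fin n → Bool) → Fin n → Bool
    choose c j = earlier c j true ≤ᵇ earlier c j false

    colouringAfter : ℕ → Fin n → Bool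
    colouringAfter zero    j = false
    colouringAfter (suc t) j = if does (toℕ j ≟ t) then choose (colouringAfter t) j else colouringAfter t j

    colouring : Fin n → Bool
    colouring = colouringAfter n

    colouringAfter-stable : ∀ t j → toℕ j < t → colouringAfter t j ≡ colouringAfter (suc (toℕ j)) j
    colouringAfter-stable (suc t) j j<1+t with toℕ j ≟ t
    ... | yes refl = refl
    ... | no  j≢t  =
      trans (colouringAfter-other t j j≢t) (colouringAfter-stable t j (≤∧≢⇒< (≤-pred j<1+t) j≢t))
      where
      colouringAfter-other : ∀ t j → toℕ j ≢ t → colouringAfter (suc t) j ≡ colouringAfter t j
      colouringAfter-other t j j≢t rewrite dec-false (toℕ j ≟ t) j≢t = refl

    colouring-earlier : ∀ {i j : Fin n} → toℕ i < toℕ j → colouring i ≡ colouringAfter (toℕ j) i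
    colouring-earlier {i} {j} i<j =
      trans (colouringAfter-stable n i (Fin.toℕ<n i)) (sym (colouringAfter-stable (toℕ j) i i<j))

    colouring-self : ∀ j → colouring j ≡ choose (colouringAfter (toℕ j)) j
    colouring-self j = trans (colouringAfter-stable n j (Fin.toℕ<n j)) chosen
      where
      chosen : colouringAfter (suc (toℕ j)) j ≡ choose (colouringAfter (toℕ j)) j
      chosen rewrite dec-true (toℕ j ≟ toℕ j) refl = refl

    backDegree≡earlier+earlier : ∀ j →
      backDegree G j ≡ earlier (colouringAfter (toℕ j)) j true + earlier (colouringAfter (toℕ j)) j false
    backDegree≡earlier+earlier j = ∑-split split
      where
      split : ∀ i → 𝟙 (i ≺ j ∧ adj G i j) ≡
        𝟙 (i ≺ j ∧ adj G i j ∧ same (colouringAfter (toℕ j) i) true) +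
        𝟙 (i ≺ j ∧ adj G i j ∧ same (colouringAfter (toℕ j) i) false)
      split i with i ≺ j | adj G i j | colouringAfter (toℕ j) i
      ... | false | _     | _     = refl
      ... | true  | false | _     = refl
      ... | true  | true  | true  = refl
      ... | true  | true  | false = refl

    backDegree-cut : ∀ j →
      backDegree (cut G colouring) j ≡ earlier (colouringAfter (toℕ j)) j (not (colouring j))
    backDegree-cut j = sum-cong-≗ pointwise
      where
      pointwise : ∀ i → 𝟙 (i ≺ j ∧ adj G i j ∧ (colouring i xor colouring j)) ≡
        𝟙 (i ≺ j ∧ adj G i j ∧ same (colouringAfter (toℕ j) i) (not (colouring j)))
      pointwise i with i ≺ j in i≺j
      ... | false = refl
      ... | true  = cong (λ b → 𝟙 (adj G i j ∧ b)) (trans (xor≡same-not (colouring i) (colouring j))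
        (cong (λ a → same a (not (colouring j))) (colouring-earlier {i} {j} (<ᵇ⇒< _ _ (subst T (sym i≺j) _)))))

    backDegree≤2backDegree-cut : ∀ j →
      backDegree G j ≤ backDegree (cut G colouring) j + backDegree (cut G colouring) j
    backDegree≤2backDegree-cut j rewrite backDegree≡earlier+earlier j | backDegree-cut j =
      by-choice (colouring j) (colouring-self j)
      where
      t f : ℕ
      t = earlier (colouringAfter (toℕ j)) j true
      f = earlier (colouringAfter (toℕ j)) j false
      by-choice : ∀ b → b ≡ (t ≤ᵇ f) →
        t + f ≤ earlier (colouringAfter (toℕ j)) j (not b) + earlier (colouringAfter (toℕ j)) j (not b)
      by-choice true  t≤f = +-monoˡ-≤ f (≤ᵇ⇒≤ t f (subst T t≤f _))
      by-choice false t≰f = +-monoʳ-≤ t (<⇒≤ (≰⇒> λ t≤f → subst T (sym t≰f) (≤⇒≤ᵇ t≤f)))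

    edges≤2edges-cut : edges G full ≤ edges (cut G colouring) full + edges (cut G colouring) full
    edges≤2edges-cut = begin
      edges G full
        ≡⟨ edges≡∑backDegree G ⟩
      ∑[ j < n ] backDegree G j
        ≤⟨ ∑-mono-≤ backDegree≤2backDegree-cut ⟩
      ∑[ j < n ] (backDegree (cut G colouring) j + backDegree (cut G colouring) j)
        ≡⟨ ∑-distrib-+ (backDegree (cut G colouring)) (backDegree (cut G colouring)) ⟩
      ∑[ j < n ] backDegree (cut G colouring) j + ∑[ j < n ] backDegree (cut G colouring) j
        ≡⟨ cong₂ _+_ (edges≡∑backDegree (cut G colouring)) (edges≡∑backDegree (cut G colouring)) ⟨
      edges (cut G colouring) full + edges (cut G colouring) full ∎
      where open ≤-Reasoning

  -- Colouring degenerate graphs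

  ProperOn : ∀ {k} → Graph n → VertexSet n → (Fin n → Fin k) → Set
  ProperOn G S col = ∀ u w → S u ≡ true → S w ≡ true → Adj G u w → col u ≢ col w

  pigeonhole : ∀ {k} (P : VertexSet n) (f : Fin n → Fin k) → (∀ a → ∃[ w ] P w ≡ true × f w ≡ a) → k ≤ ∣ P ∣ᵥ
  pigeonhole {n} {k} P f onto = begin
    k                                                  ≡⟨ ∣full∣≡n k ⟨
    ∑[ a < k ] 1                                       ≤⟨ ∑-mono-≤ hit ⟩
    ∑[ a < k ] ∑[ w < n ] when (a == f w) (𝟙 (P w))    ≡⟨ ∑-comm (λ a w → when (a == f w) (𝟙 (P w))) ⟩
    ∑[ w < n ] ∑[ a < k ] when (a == f w) (𝟙 (P w))    ≡⟨ sum-cong-≗ (λ w → ∑-when-== (f w) (λ _ → 𝟙 (P w))) ⟩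
    ∣ P ∣ᵥ                                             ∎
    where
    open ≤-Reasoning
    hit : ∀ a → 1 ≤ ∑[ w < n ] when (a == f w) (𝟙 (P w))
    hit a with onto a
    ... | w , Pw , refl = ≤-trans (≤-reflexive (sym (cong₂ when (==-refl (f w)) (cong 𝟙 Pw))))
                                  (term≤∑ (λ w′ → when (f w == f w′) (𝟙 (P w′))) w)

  free-colour : ∀ {k} (P : VertexSet n) (col : Fin n → Fin k) → ∣ P ∣ᵥ < k →
    ∃[ a ] ∀ w → P w ≡ true → col w ≢ a
  free-colour P col ∣P∣<k =
    decidable-stable (Fin.any? λ a → Fin.all? λ w → (P w Bool.≟ true) →-dec ¬? (col w Fin.≟ a))
      λ none → <⇒≱ ∣P∣<k (pigeonhole P col (used none))
    where
    used : ¬ (∃[ a ] ∀ w → P w ≡ true → col w ≢ a) → ∀ a → ∃[ w ] P w ≡ true × col w ≡ a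
    used none a = decidable-stable (Fin.any? λ w → (P w Bool.≟ true) ×-dec (col w Fin.≟ a))
      λ unused → none (a , λ w Pw cw≡a → unused (w , Pw , cw≡a))

  ProperOn-extend : ∀ {k} (G : Graph n) (S : VertexSet n) {v : Fin n} (col : Fin n → Fin k) (a : Fin k) →
    ProperOn G (S -ᵥ v) col → (∀ w → (S -ᵥ v) w ≡ true → Adj G v w → col w ≢ a) →
    ProperOn G S (λ w → if w == v then a else col w)
  ProperOn-extend G S {v} col a proper a-free u w Su Sw uw with u == v in u≡v | w == v in w≡v
  ... | true  | true  with refl ← ==⇒≡ {i = u} {v} u≡v | refl ← ==⇒≡ {i = w} {v} w≡v = λ _ → adj⇒≢ G uw refl
  ... | true  | false with refl ← ==⇒≡ {i = u} {v} u≡v = λ a≡cw → a-free w (-ᵥ-keeps S w≡v Sw) uw (sym a≡cw)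
  ... | false | true  with refl ← ==⇒≡ {i = w} {v} w≡v =
    a-free u (-ᵥ-keeps S u≡v Su) (trans (adj-sym G w u) uw)
  ... | false | false = proper u w (-ᵥ-keeps S u≡v Su) (-ᵥ-keeps S w≡v Sw) uw

  Degenerate : Graph n → ℕ → Set
  Degenerate {n} G d = ∀ (S : VertexSet n) → ∃[ w ] S w ≡ true → ∃[ v ] S v ≡ true × degree G S v ≤ d

  -- Colour a vertex of degree ≤ d last: one of d + 1 colours is free at it.
  degenerate-colouring : ∀ {d} (G : Graph n) → Degenerate G d → ∀ S → Σ (Fin n → Fin (suc d)) (ProperOn G S)
  degenerate-colouring {n} {d} G degenerate S = <-rec P colourSmaller ∣ S ∣ᵥ S refl
    where
    P : ℕ → Set
    P s = ∀ S → ∣ S ∣ᵥ ≡ s → Σ (Fin n → Fin (suc d)) (ProperOn G S)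
    colourSmaller : ∀ s → (∀ {r} → r < s → P r) → P s
    colourSmaller _ ih S refl with Fin.any? (λ w → S w Bool.≟ true)
    ... | no empty = (λ _ → zero) , λ u _ Su _ _ _ → empty (u , Su)
    ... | yes nonempty with degenerate S nonempty
    ...   | v , Sv , low with ih (≤-reflexive (sym (∣S∣≡1+∣S-v∣ S Sv))) (S -ᵥ v) refl
    ...     | col , proper with free-colour (λ w → (S -ᵥ v) w ∧ adj G v w) col
                                 (s≤s (≤-trans (degree-mono G (-ᵥ-⊆ S) v) low))
    ...       | a , a-free = _ , ProperOn-extend G S col a proper
                               λ w w∈S-v vw → a-free w (subst (λ b → b ∧ adj G v w ≡ true) (sym w∈S-v) vw)

  degenerate⇒Colourable : ∀ {d} (G : Graph n) → Degenerate G d → Colourable G (suc d)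
  degenerate⇒Colourable G degenerate with degenerate-colouring G degenerate full
  ... | col , proper = col , λ u v → proper u v refl refl

  HighMinDegree : Graph n → ℕ → VertexSet n → Set
  HighMinDegree G d S = (∃[ w ] S w ≡ true) × (∀ v → S v ≡ true → d < degree G S v)

  HighMinDegree? : ∀ (G : Graph n) d S → Dec (HighMinDegree G d S)
  HighMinDegree? G d S = Fin.any? (λ w → S w Bool.≟ true) ×-dec
                         Fin.all? (λ v → (S v Bool.≟ true) →-dec (d <? degree G S v))

  HighMinDegree-cong : ∀ (G : Graph n) {d} {S T : VertexSet n} → (∀ i → S i ≡ T i) →
    HighMinDegree G d S → HighMinDegree G d T
  HighMinDegree-cong G {S = S} {T} S≗T ((w , Sw) , high) =
    (w , trans (sym (S≗T w)) Sw) ,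
    λ v Tv → subst (_ <_) (sum-cong-≗ (λ j → cong (λ b → 𝟙 (b ∧ adj G v j)) (S≗T j)))
                          (high v (trans (S≗T v) Tv))

  ¬Colourable⇒HighMinDegree : ∀ {d} (G : Graph n) → ¬ Colourable G (suc d) → ∃ (HighMinDegree G d)
  ¬Colourable⇒HighMinDegree {n} {d} G ¬colourable
    with Subset.anySubset? {P = HighMinDegree G d ∘ Vec.lookup} (HighMinDegree? G d ∘ Vec.lookup)
  ... | yes (X , high) = Vec.lookup X , high
  ... | no none        = ⊥-elim (¬colourable (degenerate⇒Colourable G degenerate))
    where
    degenerate : Degenerate G d
    degenerate T nonempty = decidable-stable (Fin.any? λ v → (T v Bool.≟ true) ×-dec (degree G T v ≤? d))
      λ noLow → none (Vec.tabulate T , HighMinDegree-cong G (sym ∘ Vec.lookup∘tabulate T)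
                        (nonempty , λ v Tv → ≰⇒> (λ low → noLow (v , Tv , low))))

  HighMinDegree⇒edges : ∀ (G : Graph n) {d} S → HighMinDegree G d S → suc d * ∣ S ∣ᵥ ≤ edges G S + edges G S
  HighMinDegree⇒edges {n} G {d} S (_ , high) = begin
    suc d * ∣ S ∣ᵥ                           ≡⟨ ∑-when-const S (suc d) ⟨
    ∑[ i < n ] when (S i) (suc d)            ≤⟨ ∑-mono-≤ pointwise ⟩
    ∑[ i < n ] when (S i) (degree G S i)     ≡⟨ handshake G S ⟩
    edges G S + edges G S                    ∎
    where
    open ≤-Reasoning
    pointwise : ∀ i → when (S i) (suc d) ≤ when (S i) (degree G S i)
    pointwise i with S i in Si
    ... | true  = high i Si
    ... | false = z≤n

  HighMinDegree⇒nonempty : ∀ (G : Graph n) {d} S → HighMinDegree G d S → 0 < ∣ S ∣ᵥ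
  HighMinDegree⇒nonempty G S ((w , Sw) , _) = ≤-trans (≤-reflexive (cong 𝟙 (sym Sw))) (term≤∑ (𝟙 ∘ S) w)

  -- Bipartite highly connected subgraphs

  BipartiteConnectedSubgraph : Graph n → ℕ → Set
  BipartiteConnectedSubgraph G k = Σ ℕ λ p → Σ (Graph p) λ H → Subgraph H G × Bipartite H × KConnected H k

  BipartiteConnectedSubgraph-lift : {H : Graph m} {G : Graph n} {k : ℕ} →
    Subgraph H G → BipartiteConnectedSubgraph H k → BipartiteConnectedSubgraph G k
  BipartiteConnectedSubgraph-lift H⊆G (p , K , K⊆H , bipartite , conn) =
    p , K , Subgraph-trans K⊆H H⊆G , bipartite , conn

  BipartiteConnectedSubgraph-zero : (G : Graph (suc n)) → BipartiteConnectedSubgraph G 0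
  BipartiteConnectedSubgraph-zero G = 1 , K₁ , single , ((λ _ → true) , λ _ _ ()) , (s≤s z≤n , λ _ ())
    where
    K₁ : Graph 1
    K₁ = record { adj = λ _ _ → false ; adj-sym = λ _ _ → refl ; adj-irr = λ _ → refl }
    single : Subgraph K₁ G
    single = record { emb = λ _ → zero ; emb-inj = λ { {zero} {zero} _ → refl } ; emb-adj = λ _ _ () }

  cut-ConnectedSubgraph : ∀ {k} (G : Graph n) (c : Fin n → Bool) →
    ConnectedSubgraph (cut G c) k → BipartiteConnectedSubgraph G k
  cut-ConnectedSubgraph G c (p , H , H⊆cut , conn) =
    p , H , Subgraph-trans H⊆cut (cut-Subgraph G c) , Bipartite-Subgraph H⊆cut (cut-Bipartite G c) , conn

  dense⇒BipartiteConnectedSubgraph : ∀ k (G : Graph n) → 4 * n * k < edges G full →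
    BipartiteConnectedSubgraph G (suc k)
  dense⇒BipartiteConnectedSubgraph {n} k G dense = cut-ConnectedSubgraph G colouring (mader k B mader-dense)
    where
    open GreedyCut G using (colouring; edges≤2edges-cut)
    B : Graph n
    B = cut G colouring
    e : ℕ
    e = edges B full
    regroup : ∀ k n → 4 * n * k ≡ 2 * k * n + 2 * k * n
    regroup = solve-∀
    2kn<e : 2 * k * n < e
    2kn<e = x+x<y+y⇒x<y (begin-strict
      2 * k * n + 2 * k * n   ≡⟨ regroup k n ⟨
      4 * n * k               <⟨ dense ⟩
      edges G full            ≤⟨ edges≤2edges-cut ⟩
      e + e                   ∎)
      where open ≤-Reasoning
    2k<n : 2 * k < n
    2k<n = ≰⇒> λ n≤2k → <⇒≱ (+-mono-< 2kn<e 2kn<e) (begin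
      e + e                                ≤⟨ 2edges≤∣S∣² B full ⟩
      (∣ full {n} ∣ᵥ ∸ 1) * ∣ full {n} ∣ᵥ  ≡⟨ cong (λ s → (s ∸ 1) * s) (∣full∣≡n n) ⟩
      (n ∸ 1) * n                          ≤⟨ *-monoˡ-≤ n (≤-trans (m∸n≤m n 1) n≤2k) ⟩
      2 * k * n                            ≤⟨ m≤m+n _ _ ⟩
      2 * k * n + 2 * k * n                ∎)
      where open ≤-Reasoning
    mader-dense : MaderDense k B full
    mader-dense rewrite ∣full∣≡n n = 2k<n , ≤-<-trans (*-monoʳ-≤ (2 * k) (m∸n≤m n k)) 2kn<e

  chromatic⇒BipartiteConnectedSubgraph : ∀ k c (G : Graph n) → (∀ j → Colourable G j → suc c ≤ j) →
    8 * k < c → BipartiteConnectedSubgraph G (suc k)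
  chromatic⇒BipartiteConnectedSubgraph k c G minimal 8k<c
    with ¬Colourable⇒HighMinDegree {d = 8 * k} G (λ col → <⇒≱ 8k<c (≤-pred (minimal _ col)))
  ... | S , high = BipartiteConnectedSubgraph-lift (induced-Subgraph G S)
                     (dense⇒BipartiteConnectedSubgraph k (induced G S) dense)
    where
    s : ℕ
    s = ∣ S ∣ᵥ
    regroup : ∀ k s → 4 * s * k + 4 * s * k ≡ 8 * k * s
    regroup = solve-∀
    dense : 4 * s * k < edges (induced G S) full
    dense rewrite edges-induced G S = x+x<y+y⇒x<y (begin-strict
      4 * s * k + 4 * s * k   ≡⟨ regroup k s ⟩
      8 * k * s               <⟨ m<n+m _ (HighMinDegree⇒nonempty G S high) ⟩
      suc (8 * k) * s         ≤⟨ HighMinDegree⇒edges G S high ⟩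
      edges G S + edges G S   ∎)
      where open ≤-Reasoning

  BipartiteSubgraphWithConnectivity : Graph n → (ℕ → Set) → Set
  BipartiteSubgraphWithConnectivity G P =
    Σ ℕ λ p → Σ (Graph p) λ H → Subgraph H G × Bipartite H × Σ ℕ λ κ → IsConnectivity H κ × P κ

  BipartiteSubgraphWithConnectivity-map : {G : Graph n} {P Q : ℕ → Set} → (∀ {κ} → P κ → Q κ) →
    BipartiteSubgraphWithConnectivity G P → BipartiteSubgraphWithConnectivity G Q
  BipartiteSubgraphWithConnectivity-map P⇒Q (p , H , H⊆G , bipartite , κ , connectivity , Pκ) =
    p , H , H⊆G , bipartite , κ , connectivity , P⇒Q Pκ

  BipartiteConnectedSubgraph⇒connectivity : ∀ {k} (G : Graph n) → BipartiteConnectedSubgraph G k →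
    BipartiteSubgraphWithConnectivity G (k ≤_)
  BipartiteConnectedSubgraph⇒connectivity G (p , H , H⊆G , bipartite , conn) =
    p , H , H⊆G , bipartite , KConnected-maximum H conn

  bipartite-highly-connected-subgraph : (G : Graph (suc n)) (c : ℕ) → (∀ j → Colourable G j → suc c ≤ j) →
    BipartiteSubgraphWithConnectivity G λ κ → edgeCount G ≤ 4 * suc n * κ × c ≤ 8 * κ
  bipartite-highly-connected-subgraph {n} G c minimal = combine
    (ceiling-witness (BipartiteConnectedSubgraph G) (4 * suc n) (edgeCount G) (s≤s z≤n)
      (BipartiteConnectedSubgraph-zero G)
      (λ k dense → dense⇒BipartiteConnectedSubgraph k G (subst (4 * suc n * k <_) (edgeCount≡edges G) dense)))
    (ceiling-witness (BipartiteConnectedSubgraph G) 8 c (s≤s z≤n)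
      (BipartiteConnectedSubgraph-zero G)
      (λ k 8k<c → chromatic⇒BipartiteConnectedSubgraph k c G minimal 8k<c))
    where
    combine : ∃[ k₁ ] BipartiteConnectedSubgraph G k₁ × edgeCount G ≤ 4 * suc n * k₁ →
              ∃[ k₂ ] BipartiteConnectedSubgraph G k₂ × c ≤ 8 * k₂ →
              BipartiteSubgraphWithConnectivity G λ κ → edgeCount G ≤ 4 * suc n * κ × c ≤ 8 * κ
    combine (k₁ , bcs₁ , e≤4nk₁) (k₂ , bcs₂ , c≤8k₂) with upper-bound (BipartiteConnectedSubgraph G) bcs₁ bcs₂
    ... | k , bcs , k₁≤k , k₂≤k = BipartiteSubgraphWithConnectivity-map
      (λ k≤κ → ≤-trans e≤4nk₁ (*-monoʳ-≤ (4 * suc n) (≤-trans k₁≤k k≤κ)) ,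
               ≤-trans c≤8k₂ (*-monoʳ-≤ 8 (≤-trans k₂≤k k≤κ)))
      (BipartiteConnectedSubgraph⇒connectivity G bcs)

open Combinatorics using (BipartiteSubgraphWithConnectivity-map; bipartite-highly-connected-subgraph)

open import Data.Integer using (+_) renaming (_-_ to _-ℤ_)
open import Data.Rational using (ℚ; _/_; _*_; _⊔_; _≤_; toℚᵘ)
import Data.Nat as ℕ
import Data.Nat.Properties as ℕ
import Data.Integer as ℤ
import Data.Integer.Properties as ℤ
import Data.Rational.Properties as ℚ
import Data.Rational.Unnormalised as ℚᵘ
import Data.Rational.Unnormalised.Properties as ℚᵘ

-- fromℚᵘ (mkℚᵘ i d) is by definition i / suc d.
toℚᵘ-/ : ∀ i d → toℚᵘ (i / suc d) ℚᵘ.≃ ℚᵘ.mkℚᵘ i d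
toℚᵘ-/ i d = ℚ.toℚᵘ-fromℚᵘ (ℚᵘ.mkℚᵘ i d)

mkℚᵘ≤integer : ∀ i d κ → i ℤ.≤ + (suc d ℕ.* κ) → ℚᵘ.mkℚᵘ i d ℚᵘ.≤ ℚᵘ.mkℚᵘ (+ κ) 0
mkℚᵘ≤integer i d κ i≤ = ℚᵘ.*≤* (subst₂ ℤ._≤_ (sym (ℤ.*-identityʳ i))
  (trans (cong +_ (ℕ.*-comm (suc d) κ)) (ℤ.pos-* κ (suc d))) i≤)

≤integer-via-ℚᵘ : ∀ {p q} κ → toℚᵘ p ℚᵘ.≃ q → q ℚᵘ.≤ ℚᵘ.mkℚᵘ (+ κ) 0 → p ≤ (+ κ) / 1
≤integer-via-ℚᵘ κ p≃q q≤κ =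
  ℚ.toℚᵘ-cancel-≤ (ℚᵘ.≤-respˡ-≃ (ℚᵘ.≃-sym p≃q) (ℚᵘ.≤-respʳ-≃ (ℚᵘ.≃-sym (toℚᵘ-/ (+ κ) 0)) q≤κ))

[e/n]*[1/4]≤κ : ∀ e n κ → e ℕ.≤ 4 ℕ.* suc n ℕ.* κ → ((+ e) / suc n) * ((+ 1) / 4) ≤ (+ κ) / 1
[e/n]*[1/4]≤κ e n κ e≤4nκ = ≤integer-via-ℚᵘ κ product (mkℚᵘ≤integer (+ e ℤ.* + 1) _ κ e*1≤)
  where
  product : toℚᵘ (((+ e) / suc n) * ((+ 1) / 4)) ℚᵘ.≃ ℚᵘ.mkℚᵘ (+ e) n ℚᵘ.* ℚᵘ.mkℚᵘ (+ 1) 3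
  product = ℚᵘ.≃-trans (ℚ.toℚᵘ-homo-* ((+ e) / suc n) ((+ 1) / 4))
                       (ℚᵘ.*-cong (toℚᵘ-/ (+ e) n) (toℚᵘ-/ (+ 1) 3))
  e*1≤ : + e ℤ.* + 1 ℤ.≤ + (suc n ℕ.* 4 ℕ.* κ)
  e*1≤ = subst (ℤ._≤ _) (sym (ℤ.*-identityʳ (+ e)))
           (ℤ.+≤+ (subst (e ℕ.≤_) (cong (ℕ._* κ) (ℕ.*-comm 4 (suc n))) e≤4nκ))

c/8≤κ : ∀ c κ → c ℕ.≤ 8 ℕ.* κ → (+ c) / 8 ≤ (+ κ) / 1
c/8≤κ c κ c≤8κ = ≤integer-via-ℚᵘ κ (toℚᵘ-/ (+ c) 7) (mkℚᵘ≤integer (+ c) 7 κ (ℤ.+≤+ c≤8κ))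

corollary3p2 : ∀ {n} .{{_ : NonZero n}} (G : Graph n) (χ : ℕ) → IsChromatic G χ →
    Σ ℕ λ m → Σ (Graph m) λ H → Subgraph H G × Bipartite H ×
      Σ ℕ λ κ → IsConnectivity H κ ×
        ((density G * ((+ 1) / 4)) ⊔ (((+ χ) -ℤ (+ 1)) / 8)) ≤ ((+ κ) / 1)
corollary3p2 {suc n} G zero    ((colour , _) , _) = ⊥-elim (Fin.¬Fin0 (colour zero))
corollary3p2 {suc n} G (suc c) (_ , minimal)       =
  -- (+ suc c) -ℤ (+ 1) reduces to + c.
  BipartiteSubgraphWithConnectivity-map
    (λ {κ} (e≤4nκ , c≤8κ) → ℚ.⊔-lub ([e/n]*[1/4]≤κ (edgeCount G) n κ e≤4nκ) (c/8≤κ c κ c≤8κ))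
    (bipartite-highly-connected-subgraph G c minimal)
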